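{- Let $f(x,y,z)=xyz-x-z$ (the critical polynomial of the path $A_3$ on three vertices). The set $V_{A_3}(2)$ contains: (a) all even positive integers $n$, except possibly those of the form $n=2^m-2$ with $m$ odd or $m\in\{2,4\}$; (b) all odd positive integers $n$ such that $n+2$ is not prime; (c) all odd positive integers congruent to $1$ modulo $4$ and congruent to $2$ or $8$ modulo $9$.
   Context: For a graph $G$ with vertices $v_1,\dots,v_n$ and adjacency matrix $A_G$, $M_G(a_1,\dots,a_n)=\mathrm{Diag}(a_1,\dots,a_n)-A_G$. For the path $A_3$ with vertices in order, $\det M_{A_3}(x,y,z)=xyz-x-z$. For $M\in M_n(\mathbb{Z})$, $\Phi_M$ is the torsion subgroup of $\mathbb{Z}^n/\mathrm{Im}(M)$. $V_G(r)$ is the set of $u\in\mathbb{Z}_{\ge0}$ for which there exist integers $a_1,\dots,a_n\ge r$ with $u=\det M_G(a_1,\dots,a_n)$, such that $M_G(a_1,\dots,a_n)$ is positive definite (${}^tXMX>0$ for nonzero integer $X$) if $u\neq 0$ and positive semi-definite of rank $n-1$ if $u=0$, and such that $\Phi_{M_G(a_1,\dots,a_n)}$ is cyclic. -}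

module Defs where

open import Data.Nat using (ℕ)
open import Data.Integer using (ℤ; +_; _+_; _-_; _*_; -_; _≤_; _<_; 0ℤ)
open import Data.Fin using (Fin; zero; suc)
open import Data.Product using (Σ; ∃; _×_; _,_)
open import Relation.Binary.PropositionalEquality using (_≡_; _≢_)
open import Relation.Nullary using (¬_)

Vecℤ : ℕ → Set
Vecℤ n = Fin n → ℤ

Matℤ : ℕ → Set
Matℤ n = Fin n → Fin n → ℤ

sumFin : {n : ℕ} → (Fin n → ℤ) → ℤ
sumFin {ℕ.zero}  f = 0ℤ
sumFin {ℕ.suc n} f = f zero + sumFin (λ i → f (suc i))

_·_ : {n : ℕ} → Matℤ n → Vecℤ n → Vecℤ n
(M · X) i = sumFin (λ j → M i j * X j)

quad : {n : ℕ} → Matℤ n → Vecℤ n → ℤ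
quad M X = sumFin (λ i → X i * (M · X) i)

IsZeroVec : {n : ℕ} → Vecℤ n → Set
IsZeroVec X = ∀ i → X i ≡ 0ℤ

PosDef : {n : ℕ} → Matℤ n → Set
PosDef M = ∀ X → ¬ IsZeroVec X → 0ℤ < quad M X

PosSemiDef : {n : ℕ} → Matℤ n → Set
PosSemiDef M = ∀ X → 0ℤ ≤ quad M X

Diag : {n : ℕ} → Vecℤ n → Matℤ n
Diag {ℕ.suc n} a zero    zero    = a zero
Diag {ℕ.suc n} a zero    (suc j) = 0ℤ
Diag {ℕ.suc n} a (suc i) zero    = 0ℤ
Diag {ℕ.suc n} a (suc i) (suc j) = Diag (λ k → a (suc k)) i j

_-ᴹ_ : {n : ℕ} → Matℤ n → Matℤ n → Matℤ n
(M -ᴹ N) i j = M i j - N i j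

adjA3 : Matℤ 3
adjA3 zero          (suc zero)    = + 1
adjA3 (suc zero)    zero          = + 1
adjA3 (suc zero)    (suc (suc zero)) = + 1
adjA3 (suc (suc zero)) (suc zero) = + 1
adjA3 _ _ = 0ℤ

M-A3 : Vecℤ 3 → Matℤ 3
M-A3 a = Diag a -ᴹ adjA3

i0 i1 i2 : Fin 3
i0 = zero
i1 = suc zero
i2 = suc (suc zero)

det3 : Matℤ 3 → ℤ
det3 M =
    M i0 i0 * (M i1 i1 * M i2 i2 - M i1 i2 * M i2 i1)
  - M i0 i1 * (M i1 i0 * M i2 i2 - M i1 i2 * M i2 i0)
  + M i0 i2 * (M i1 i0 * M i2 i1 - M i1 i1 * M i2 i0)

minor2 : Matℤ 3 → Fin 3 → Fin 3 → Fin 3 → Fin 3 → ℤ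
minor2 M r₁ r₂ c₁ c₂ = M r₁ c₁ * M r₂ c₂ - M r₁ c₂ * M r₂ c₁

Rank2 : Matℤ 3 → Set
Rank2 M = det3 M ≡ 0ℤ × ∃ λ r₁ → ∃ λ r₂ → ∃ λ c₁ → ∃ λ c₂ → minor2 M r₁ r₂ c₁ c₂ ≢ 0ℤ

InIm : {n : ℕ} → Matℤ n → Vecℤ n → Set
InIm M v = ∃ λ w → ∀ i → (M · w) i ≡ v i

-- v represents a torsion element of ℤⁿ / Im(M)
IsTorsion : {n : ℕ} → Matℤ n → Vecℤ n → Set
IsTorsion M v = ∃ λ (k : ℤ) → k ≢ 0ℤ × InIm M (λ i → k * v i)

-- Φ_M (torsion subgroup of ℤⁿ/Im M) is cyclic: it is generated by the
-- class of a single torsion element g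
PhiCyclic : {n : ℕ} → Matℤ n → Set
PhiCyclic M = ∃ λ g → IsTorsion M g ×
  (∀ v → IsTorsion M v → ∃ λ (j : ℤ) → InIm M (λ i → v i - j * g i))

InV-A3 : ℤ → ℕ → Set
InV-A3 r u = ∃ λ (a : Vecℤ 3) →
    (∀ i → r ≤ a i)
  × (+ u ≡ det3 (M-A3 a))
  × (u ≢ 0 → PosDef (M-A3 a))
  × (u ≡ 0 → PosSemiDef (M-A3 a) × Rank2 (M-A3 a))
  × PhiCyclic (M-A3 a)

{-# OPTIONS --safe #-}
module Submission where

-- For x, y, z ≥ 2 the matrix M = M_{A₃}(x,y,z) has quadratic form
-- Σ (aᵢ − 2) Xᵢ² + X₀² + (X₀ − X₁)² + (X₁ − X₂)² + X₂², so it is positive definite;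
-- its determinant is f(x,y,z) = xyz − x − z, and ℤ³/Im M is cyclic, generated by e₀,
-- because M has a unimodular 2×2 minor. Hence every positive value of f on [2,∞)³
-- lies in V_{A₃}(2), and the three families are such values:
-- f(d, k+2, 2) = d(2k+3) − 2 covers every n for which n + 2 has an odd factor ≥ 3
-- with cofactor ≥ 2, which is (b) and the even n with n + 2 not a power of two;
-- f(6, y, 4) = 24y − 10 covers n = 4ʲ − 2 for j ≥ 3, as 24 ∣ 4ʲ + 8;
-- f(3, y, 4) = 12y − 7 covers (c), whose n are ≡ 5 (mod 12) and different from 5.

open import Defs

module A3Matrix where
  open import Data.Fin using (zero; suc)
  open import Data.Integer
  open import Data.Integer.Properties
  open import Data.Integer.Tactic.RingSolver using (solve-∀)
  import Data.Nat as ℕ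
  open import Function using (_∘_)
  open import Relation.Nullary using (¬_; yes; no; contradiction)
  open import Data.Product using (∃; _×_; _,_)
  open import Relation.Binary.PropositionalEquality
  open ≡-Reasoning

  vec3 : ℤ → ℤ → ℤ → Vecℤ 3
  vec3 a b c zero             = a
  vec3 a b c (suc zero)       = b
  vec3 a b c (suc (suc zero)) = c

  -- The ring solver works on syntax, so identities about M-A3 are stated on the
  -- definitional unfolding of their left-hand sides.
  M-A3-· : ∀ p q r w →
    M-A3 (vec3 p q r) · w ≗ vec3 (p * w i0 - w i1) (q * w i1 - w i0 - w i2) (r * w i2 - w i1)
  M-A3-· p q r w zero             = row₀ p (w i0) (w i1) (w i2)
    where
    row₀ : ∀ p a b c → (p - 0ℤ) * a + ((0ℤ - + 1) * b + ((0ℤ - 0ℤ) * c + 0ℤ)) ≡ p * a - b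
    row₀ = solve-∀
  M-A3-· p q r w (suc zero)       = row₁ q (w i0) (w i1) (w i2)
    where
    row₁ : ∀ q a b c → (0ℤ - + 1) * a + ((q - 0ℤ) * b + ((0ℤ - + 1) * c + 0ℤ)) ≡ q * b - a - c
    row₁ = solve-∀
  M-A3-· p q r w (suc (suc zero)) = row₂ r (w i0) (w i1) (w i2)
    where
    row₂ : ∀ r a b c → (0ℤ - 0ℤ) * a + ((0ℤ - + 1) * b + ((r - 0ℤ) * c + 0ℤ)) ≡ r * c - b
    row₂ = solve-∀

  det-M-A3 : ∀ p q r → det3 (M-A3 (vec3 p q r)) ≡ p * q * r - p - r
  det-M-A3 = expansion
    where
    expansion : ∀ p q r →
        (p - 0ℤ) * ((q - 0ℤ) * (r - 0ℤ) - (0ℤ - + 1) * (0ℤ - + 1))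
      - (0ℤ - + 1) * ((0ℤ - + 1) * (r - 0ℤ) - (0ℤ - + 1) * (0ℤ - 0ℤ))
      + (0ℤ - 0ℤ) * ((0ℤ - + 1) * (0ℤ - + 1) - (q - 0ℤ) * (0ℤ - 0ℤ))
      ≡ p * q * r - p - r
    expansion = solve-∀

  cartanForm-A3 : ℤ → ℤ → ℤ → ℤ
  cartanForm-A3 a b c = a * a + ((a - b) * (a - b) + ((b - c) * (b - c) + c * c))

  quad-M-A3 : ∀ p q r X → let a = X i0; b = X i1; c = X i2 in
    quad (M-A3 (vec3 p q r)) X
      ≡ ((p - + 2) * (a * a) + (q - + 2) * (b * b) + (r - + 2) * (c * c)) + cartanForm-A3 a b c
  quad-M-A3 p q r X = begin
    quad (M-A3 (vec3 p q r)) X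
      ≡⟨ cong₂ _+_ (cong (a *_) (M-A3-· p q r X i0))
           (cong₂ _+_ (cong (b *_) (M-A3-· p q r X i1))
             (cong (λ t → c * t + 0ℤ) (M-A3-· p q r X i2))) ⟩
    a * (p * a - b) + (b * (q * b - a - c) + (c * (r * c - b) + 0ℤ))
      ≡⟨ regroup p q r a b c ⟩
    ((p - + 2) * (a * a) + (q - + 2) * (b * b) + (r - + 2) * (c * c)) + cartanForm-A3 a b c ∎
    where
    a b c : ℤ
    a = X i0
    b = X i1
    c = X i2
    regroup : ∀ p q r a b c →
      a * (p * a - b) + (b * (q * b - a - c) + (c * (r * c - b) + 0ℤ))
        ≡ ((p - + 2) * (a * a) + (q - + 2) * (b * b) + (r - + 2) * (c * c))
          + (a * a + ((a - b) * (a - b) + ((b - c) * (b - c) + c * c)))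
    regroup = solve-∀

  0≤i*i : ∀ i → 0ℤ ≤ i * i
  0≤i*i +0       = +≤+ ℕ.z≤n
  0≤i*i +[1+ n ] = +≤+ ℕ.z≤n
  0≤i*i -[1+ n ] = +≤+ ℕ.z≤n

  0<i*i : ∀ {i} → i ≢ 0ℤ → 0ℤ < i * i
  0<i*i {+0}       i≢0 = contradiction refl i≢0
  0<i*i {+[1+ n ]} _   = +<+ (ℕ.s≤s ℕ.z≤n)
  0<i*i { -[1+ n ]} _  = +<+ (ℕ.s≤s ℕ.z≤n)

  0≤i⇒0≤j⇒0≤i*j : ∀ {i j} → 0ℤ ≤ i → 0ℤ ≤ j → 0ℤ ≤ i * j
  0≤i⇒0≤j⇒0≤i*j {+ m} {+ n} _ _ = subst (0ℤ ≤_) (pos-* m n) (+≤+ ℕ.z≤n)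

  cartanForm-A3-pos : ∀ a b c → ¬ (a ≡ 0ℤ × b ≡ 0ℤ × c ≡ 0ℤ) → 0ℤ < cartanForm-A3 a b c
  cartanForm-A3-pos a b c nonzero with a ≟ 0ℤ | c ≟ 0ℤ | b ≟ 0ℤ
  ... | no a≢0 | _ | _ =
    +-mono-<-≤ (0<i*i a≢0) (+-mono-≤ (0≤i*i (a - b)) (+-mono-≤ (0≤i*i (b - c)) (0≤i*i c)))
  ... | yes refl | no c≢0 | _ =
    +-mono-≤-< (0≤i*i 0ℤ) (+-mono-≤-< (0≤i*i (0ℤ - b)) (+-mono-≤-< (0≤i*i (b - c)) (0<i*i c≢0)))
  ... | yes refl | yes refl | no b≢0 =
    +-mono-≤-< (0≤i*i 0ℤ) (+-mono-≤-< (0≤i*i (0ℤ - b))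
      (+-mono-<-≤ (0<i*i (b≢0 ∘ trans (sym (+-identityʳ b)))) (0≤i*i 0ℤ)))
  ... | yes refl | yes refl | yes refl = contradiction (refl , refl , refl) nonzero

  M-A3-posDef : ∀ {p q r} → + 2 ≤ p → + 2 ≤ q → + 2 ≤ r → PosDef (M-A3 (vec3 p q r))
  M-A3-posDef {p} {q} {r} 2≤p 2≤q 2≤r X X≢0 =
    subst (0ℤ <_) (sym (quad-M-A3 p q r X))
      (+-mono-≤-< (+-mono-≤ (+-mono-≤ (weighted≥0 2≤p (X i0)) (weighted≥0 2≤q (X i1)))
                                       (weighted≥0 2≤r (X i2)))
                  (cartanForm-A3-pos (X i0) (X i1) (X i2) λ (a≡0 , b≡0 , c≡0) →
                    X≢0 λ { zero → a≡0 ; (suc zero) → b≡0 ; (suc (suc zero)) → c≡0 }))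
    where
    weighted≥0 : ∀ {s} → + 2 ≤ s → ∀ a → 0ℤ ≤ (s - + 2) * (a * a)
    weighted≥0 2≤s a = 0≤i⇒0≤j⇒0≤i*j (i≤j⇒0≤j-i 2≤s) (0≤i*i a)

  M-A3-phiCyclic : ∀ p q r → det3 (M-A3 (vec3 p q r)) ≢ 0ℤ → PhiCyclic (M-A3 (vec3 p q r))
  M-A3-phiCyclic p q r det≢0 =
    e₀ , (det , det≢0 , u , det·e₀∈Im) , cosetOf-e₀
    where
    M : Matℤ 3
    M = M-A3 (vec3 p q r)
    det : ℤ
    det = det3 M
    e₀ u : Vecℤ 3
    e₀ = vec3 (+ 1) 0ℤ 0ℤ
    u = vec3 (q * r - + 1) r (+ 1)

    det·e₀∈Im : ∀ i → (M · u) i ≡ det * e₀ i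
    det·e₀∈Im i = trans (M-A3-· p q r u i) (rows i)
      where
      row₀ : ∀ p q r → p * (q * r - + 1) - r ≡ (p * q * r - p - r) * + 1
      row₀ = solve-∀
      row₁ : ∀ q r d → q * r - (q * r - + 1) - + 1 ≡ d * 0ℤ
      row₁ = solve-∀
      row₂ : ∀ r d → r * + 1 - r ≡ d * 0ℤ
      row₂ = solve-∀
      rows : ∀ i → vec3 (p * (q * r - + 1) - r) (q * r - (q * r - + 1) - + 1) (r * + 1 - r) i
                   ≡ det * e₀ i
      rows zero             = trans (row₀ p q r) (cong (_* + 1) (sym (det-M-A3 p q r)))
      rows (suc zero)       = row₁ q r det
      rows (suc (suc zero)) = row₂ r det

    cosetOf-e₀ : ∀ v → IsTorsion M v → ∃ λ j → InIm M (λ i → v i - j * e₀ i)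
    cosetOf-e₀ v _ = j , w , λ i → trans (M-A3-· p q r w i) (rows i)
      where
      v₀ v₁ v₂ j : ℤ
      v₀ = v i0
      v₁ = v i1
      v₂ = v i2
      j = v₀ + p * v₁ + (p * q - + 1) * v₂
      w : Vecℤ 3
      w = vec3 (- (v₁ + q * v₂)) (- v₂) 0ℤ
      row₀ : ∀ p q v₀ v₁ v₂ →
        p * - (v₁ + q * v₂) - - v₂ ≡ v₀ - (v₀ + p * v₁ + (p * q - + 1) * v₂) * + 1
      row₀ = solve-∀
      row₁ : ∀ q v₁ v₂ j → q * - v₂ - - (v₁ + q * v₂) - 0ℤ ≡ v₁ - j * 0ℤ
      row₁ = solve-∀
      row₂ : ∀ r v₂ j → r * 0ℤ - - v₂ ≡ v₂ - j * 0ℤ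
      row₂ = solve-∀
      rows : ∀ i → vec3 (p * w i0 - w i1) (q * w i1 - w i0 - w i2) (r * w i2 - w i1) i
                   ≡ v i - j * e₀ i
      rows zero             = row₀ p q v₀ v₁ v₂
      rows (suc zero)       = row₁ q v₁ v₂ j
      rows (suc (suc zero)) = row₂ r v₂ j

  +n≡det-M-A3 : ∀ {n x y z} → n ℕ.+ x ℕ.+ z ≡ x ℕ.* y ℕ.* z →
    + n ≡ det3 (M-A3 (vec3 (+ x) (+ y) (+ z)))
  +n≡det-M-A3 {n} {x} {y} {z} n+x+z≡xyz = begin
    + n                                 ≡⟨ cancel (+ n) (+ x) (+ z) ⟩
    + (n ℕ.+ x ℕ.+ z) - + x - + z       ≡⟨ cong (λ t → + t - + x - + z) n+x+z≡xyz ⟩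
    + (x ℕ.* y ℕ.* z) - + x - + z       ≡⟨ cong (λ t → t - + x - + z) +xyz≡+x*+y*+z ⟩
    + x * + y * + z - + x - + z         ≡⟨ det-M-A3 (+ x) (+ y) (+ z) ⟨
    det3 (M-A3 (vec3 (+ x) (+ y) (+ z))) ∎
    where
    cancel : ∀ a b c → a ≡ a + b + c - b - c
    cancel = solve-∀
    +xyz≡+x*+y*+z : + (x ℕ.* y ℕ.* z) ≡ + x * + y * + z
    +xyz≡+x*+y*+z = trans (pos-* (x ℕ.* y) z) (cong (_* + z) (pos-* x y))

open A3Matrix using (vec3; +n≡det-M-A3; M-A3-posDef; M-A3-phiCyclic)

open import Data.Nat
open import Data.Nat.Properties
open import Data.Nat.Divisibility
open import Data.Nat.DivMod
open import Data.Nat.LCM using (lcm-least)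
open import Data.Nat.Primality using (Prime; ¬prime⇒composite; composite)
open import Data.Nat.Induction using (<-wellFounded)
open import Data.Nat.Tactic.RingSolver using (solve-∀; solve)
open import Data.List using (_∷_; [])
open import Induction.WellFounded using (Acc; acc)
open import Data.Integer using (+_; +≤+) renaming (_≤_ to _≤ℤ_)
open import Data.Integer.Properties using (+-injective)
open import Data.Fin using (zero; suc)
open import Data.Product using (∃; ∃₂; _×_; _,_)
open import Data.Sum using (_⊎_; inj₁; inj₂; [_,_]′)
open import Relation.Nullary using (¬_; contradiction)
open import Relation.Binary.PropositionalEquality
open import Function using (_∘_)

xyz-x-z∈V-A3 : ∀ {n} x y z → 0 < n → 2 ≤ x → 2 ≤ y → 2 ≤ z → n + x + z ≡ x * y * z →
  InV-A3 (+ 2) n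
xyz-x-z∈V-A3 {n} x y z n>0 2≤x 2≤y 2≤z n+x+z≡xyz =
  vec3 (+ x) (+ y) (+ z) , entries≥2 , n≡det ,
  (λ _ → M-A3-posDef (+≤+ 2≤x) (+≤+ 2≤y) (+≤+ 2≤z)) ,
  (λ n≡0 → contradiction n≡0 (n>0⇒n≢0 n>0)) ,
  M-A3-phiCyclic (+ x) (+ y) (+ z) (n>0⇒n≢0 n>0 ∘ +-injective ∘ trans n≡det)
  where
  n≡det : + n ≡ det3 (M-A3 (vec3 (+ x) (+ y) (+ z)))
  n≡det = +n≡det-M-A3 n+x+z≡xyz
  entries≥2 : ∀ i → + 2 ≤ℤ vec3 (+ x) (+ y) (+ z) i
  entries≥2 zero             = +≤+ 2≤x
  entries≥2 (suc zero)       = +≤+ 2≤y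
  entries≥2 (suc (suc zero)) = +≤+ 2≤z

n+2≡d*[3+2k]⇒∈V-A3 : ∀ {n} d k → 0 < n → 2 ≤ d → n + 2 ≡ d * (3 + 2 * k) → InV-A3 (+ 2) n
n+2≡d*[3+2k]⇒∈V-A3 {n} d k n>0 2≤d n+2≡d*[3+2k] =
  xyz-x-z∈V-A3 d (2 + k) 2 n>0 2≤d (m≤m+n 2 k) ≤-refl (begin
    n + d + 2          ≡⟨ solve (n ∷ d ∷ []) ⟩
    n + 2 + d          ≡⟨ cong (_+ d) n+2≡d*[3+2k] ⟩
    d * (3 + 2 * k) + d ≡⟨ solve (d ∷ k ∷ []) ⟩
    d * (2 + k) * 2    ∎)
  where open ≡-Reasoning

even⊎odd : ∀ n → (∃ λ h → n ≡ 2 * h) ⊎ (∃ λ h → n ≡ 1 + 2 * h)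
even⊎odd zero = inj₁ (0 , refl)
even⊎odd (suc n) with even⊎odd n
... | inj₁ (h , refl) = inj₂ (h , refl)
... | inj₂ (h , refl) = inj₁ (suc h , sym (*-suc 2 h))

¬2∣1+2*h : ∀ h → ¬ 2 ∣ 1 + 2 * h
¬2∣1+2*h h (divides q 1+2h≡q*2) = even≢odd q h (trans (*-comm 2 q) (sym 1+2h≡q*2))

odd⇒≡3+2*k : ∀ {q} → ¬ 2 ∣ q → 2 ≤ q → ∃ λ k → q ≡ 3 + 2 * k
odd⇒≡3+2*k {q} q-odd 2≤q with even⊎odd q
... | inj₁ (h , refl)     = contradiction (m∣m*n h) q-odd
... | inj₂ (zero , refl)  = contradiction 2≤q λ { (s≤s ()) }
... | inj₂ (suc k , refl) = k , cong suc (*-suc 2 k)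

n≡2^m*[1+2o] : ∀ {n} → 0 < n → ∃₂ λ m o → n ≡ 2 ^ m * (1 + 2 * o)
n≡2^m*[1+2o] {n} = go n (<-wellFounded n)
  where
  go : ∀ n → Acc _<_ n → 0 < n → ∃₂ λ m o → n ≡ 2 ^ m * (1 + 2 * o)
  go n (acc rec) n>0 with even⊎odd n
  ... | inj₂ (o , refl)      = 0 , o , sym (*-identityˡ (1 + 2 * o))
  ... | inj₁ (zero , refl)   = contradiction n>0 λ ()
  ... | inj₁ (suc h , refl) with go (suc h) (rec (m<m+n (suc h) z<s)) z<s
  ...   | m , o , 1+h≡2^m*[1+2o] =
    suc m , o , trans (cong (2 *_) 1+h≡2^m*[1+2o]) (sym (*-assoc 2 (2 ^ m) (1 + 2 * o)))

4^[3+j]+8≡24*[2+y] : ∀ j → ∃ λ y → 4 ^ (3 + j) + 8 ≡ 24 * (2 + y)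
4^[3+j]+8≡24*[2+y] zero = 1 , refl
4^[3+j]+8≡24*[2+y] (suc j) with 4^[3+j]+8≡24*[2+y] j
... | y , 4^[3+j]+8≡24*[2+y] = 5 + 4 * y , +-cancelʳ-≡ 24 _ _ (begin
  4 * 4 ^ (3 + j) + 8 + 24    ≡⟨ distrib (4 ^ (3 + j)) ⟩
  4 * (4 ^ (3 + j) + 8)       ≡⟨ cong (4 *_) 4^[3+j]+8≡24*[2+y] ⟩
  4 * (24 * (2 + y))          ≡⟨ solve (y ∷ []) ⟩
  24 * (2 + (5 + 4 * y)) + 24 ∎)
  where
  open ≡-Reasoning
  distrib : ∀ a → 4 * a + 8 + 24 ≡ 4 * (a + 8)
  distrib = solve-∀

n+2≡2^k⇒∈V-A3 : ∀ {n} k → 0 < n → n + 2 ≡ 2 ^ k → ¬ (¬ 2 ∣ k ⊎ k ≡ 2 ⊎ k ≡ 4) →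
  InV-A3 (+ 2) n
n+2≡2^k⇒∈V-A3 {n} k n>0 n+2≡2^k ¬k-exceptional with even⊎odd k
... | inj₂ (h , refl) = contradiction (inj₁ (¬2∣1+2*h h)) ¬k-exceptional
... | inj₁ (0 , refl) = contradiction (trans (+-comm 2 n) n+2≡2^k) λ ()
... | inj₁ (1 , refl) = contradiction (inj₂ (inj₁ refl)) ¬k-exceptional
... | inj₁ (2 , refl) = contradiction (inj₂ (inj₂ refl)) ¬k-exceptional
... | inj₁ (suc (suc (suc j)) , refl) with 4^[3+j]+8≡24*[2+y] j
...   | y , 4^[3+j]+8≡24*[2+y] =
  xyz-x-z∈V-A3 6 (2 + y) 4 n>0 (m≤m+n 2 4) (m≤m+n 2 y) (m≤m+n 2 2) (begin
  n + 6 + 4       ≡⟨ solve (n ∷ []) ⟩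
  n + 2 + 8       ≡⟨ cong (_+ 8) (trans n+2≡2^k (sym (^-*-assoc 2 2 (3 + j)))) ⟩
  4 ^ (3 + j) + 8 ≡⟨ 4^[3+j]+8≡24*[2+y] ⟩
  24 * (2 + y)    ≡⟨ solve (y ∷ []) ⟩
  6 * (2 + y) * 4 ∎)
  where open ≡-Reasoning

even∈V-A3 : ∀ {n} → 0 < n → 2 ∣ n → ¬ (∃ λ k → n + 2 ≡ 2 ^ k × (¬ 2 ∣ k ⊎ k ≡ 2 ⊎ k ≡ 4)) →
  InV-A3 (+ 2) n
even∈V-A3 {n} n>0 2∣n ¬exceptional with n≡2^m*[1+2o] {n + 2} (<-≤-trans n>0 (m≤m+n n 2))
... | zero , o , n+2≡1+2o =
  contradiction (subst (2 ∣_) (trans n+2≡1+2o (*-identityˡ (1 + 2 * o))) (∣m∣n⇒∣m+n 2∣n ∣-refl))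
    (¬2∣1+2*h o)
... | k , zero , n+2≡2^k*1 =
  n+2≡2^k⇒∈V-A3 k n>0 n+2≡2^k λ k-exceptional → ¬exceptional (k , n+2≡2^k , k-exceptional)
  where
  n+2≡2^k : n + 2 ≡ 2 ^ k
  n+2≡2^k = trans n+2≡2^k*1 (*-identityʳ (2 ^ k))
... | suc k , suc o , n+2≡2^[1+k]*[1+2[1+o]] =
  n+2≡d*[3+2k]⇒∈V-A3 (2 ^ suc k) o n>0 (*-monoʳ-≤ 2 (m^n>0 2 k))
    (trans n+2≡2^[1+k]*[1+2[1+o]] (cong ((2 ^ suc k) *_) (cong suc (*-suc 2 o))))

cofactor≡3+2k : ∀ {n d q} → ¬ 2 ∣ n → d < n + 2 → n + 2 ≡ q * d → ∃ λ k → q ≡ 3 + 2 * k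
cofactor≡3+2k {n} {d} {q} n-odd d<n+2 n+2≡q*d = odd⇒≡3+2*k q-odd 1<q
  where
  q-odd : ¬ 2 ∣ q
  q-odd 2∣q = n-odd (∣m+n∣m⇒∣n 2∣2+n ∣-refl)
    where
    2∣2+n : 2 ∣ 2 + n
    2∣2+n = subst (2 ∣_) (trans (sym n+2≡q*d) (+-comm n 2)) (∣-trans 2∣q (m∣m*n d))
  1<q : 1 < q
  1<q = *-cancelʳ-< d 1 q (subst₂ _<_ (sym (*-identityˡ d)) n+2≡q*d d<n+2)

n+2-composite⇒∈V-A3 : ∀ {n} → 0 < n → ¬ 2 ∣ n → ¬ Prime (n + 2) → InV-A3 (+ 2) n
n+2-composite⇒∈V-A3 {n} n>0 n-odd n+2-composite
  with ¬prime⇒composite {{n>1⇒nonTrivial (m≤n+m 2 n)}} n+2-composite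
... | composite {d} d<n+2 (divides q n+2≡q*d)
  with cofactor≡3+2k {q = q} n-odd d<n+2 n+2≡q*d
...   | k , refl =
  n+2≡d*[3+2k]⇒∈V-A3 d k n>0 (nonTrivial⇒n>1 d) (trans n+2≡q*d (*-comm _ d))

12∣n+7 : ∀ {n} → n % 4 ≡ 1 → n % 9 ≡ 2 ⊎ n % 9 ≡ 8 → 12 ∣ n + 7
12∣n+7 {n} n%4≡1 n%9≡2∨8 = lcm-least 4∣n+7 3∣n+7
  where
  n%3≡2 : n % 3 ≡ 2
  n%3≡2 = trans (sym (m∣n⇒o%n%m≡o%m 3 9 n (divides 3 refl)))
                ([ cong (_% 3) , cong (_% 3) ]′ n%9≡2∨8)
  4∣n+7 : 4 ∣ n + 7
  4∣n+7 = m%n≡0⇒n∣m (n + 7) 4 (trans (%-distribˡ-+ n 7 4) (cong (λ r → (r + 7 % 4) % 4) n%4≡1))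
  3∣n+7 : 3 ∣ n + 7
  3∣n+7 = m%n≡0⇒n∣m (n + 7) 3 (trans (%-distribˡ-+ n 7 3) (cong (λ r → (r + 7 % 3) % 3) n%3≡2))

n%4≡1⇒n%9≡2∨8⇒∈V-A3 : ∀ {n} → 0 < n → n % 4 ≡ 1 → n % 9 ≡ 2 ⊎ n % 9 ≡ 8 → InV-A3 (+ 2) n
n%4≡1⇒n%9≡2∨8⇒∈V-A3 {n} n>0 n%4≡1 n%9≡2∨8 with 12∣n+7 n%4≡1 n%9≡2∨8
... | divides zero n+7≡0 = contradiction (trans (+-comm 7 n) n+7≡0) λ ()
... | divides (suc zero) n+7≡12 =
  [ (λ ()) , (λ ()) ]′ (subst (λ m → m % 9 ≡ 2 ⊎ m % 9 ≡ 8) (+-cancelʳ-≡ 7 n 5 n+7≡12) n%9≡2∨8)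
... | divides (suc (suc y)) n+7≡[2+y]*12 =
  xyz-x-z∈V-A3 3 (2 + y) 4 n>0 (m≤m+n 2 1) (m≤m+n 2 y) (m≤m+n 2 2)
    (trans (+-assoc n 3 4) (trans n+7≡[2+y]*12 (solve (y ∷ []))))

proposition6p3 :
    (∀ n → 0 < n → 2 ∣ n →
       ¬ (∃ λ m → n + 2 ≡ 2 ^ m × (¬ (2 ∣ m) ⊎ m ≡ 2 ⊎ m ≡ 4)) →
       InV-A3 (+ 2) n)
    × (∀ n → 0 < n → ¬ (2 ∣ n) → ¬ Prime (n + 2) → InV-A3 (+ 2) n)
    × (∀ n → 0 < n → ¬ (2 ∣ n) → n % 4 ≡ 1 → (n % 9 ≡ 2 ⊎ n % 9 ≡ 8) →
       InV-A3 (+ 2) n)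
proposition6p3 =
    (λ _ → even∈V-A3)
  , (λ _ → n+2-composite⇒∈V-A3)
  , (λ _ n>0 _ → n%4≡1⇒n%9≡2∨8⇒∈V-A3 n>0)
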